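{- Let $(\delta,K_1,K_2,C_0,C_1)$ be admissible, let $M$ be a magic distance, and let $\mathbf C$ be a $K_1$-cycle with at least 4 vertices. Then there is a pair of neighbouring edges of $\mathbf C$ with labels $a,b$ such that $a+b<K_1$; in particular $\mathbf C$ has a tension.
   Context: A $\delta$-edge-labelled cycle is a cycle graph (at least 3 vertices) with edge labels in $\{1,\dots,\delta\}$; two edges are neighbouring if they share a vertex. A cycle is non-metric if some label exceeds the sum of all other labels, metric otherwise. A $K_1$-cycle is a metric cycle of odd perimeter (sum of labels) with labels $x_1,\dots,x_k$ such that $\sum x_i<2K_1$. Parameters: integers with $3\le\delta<\infty$, $1\le K_1\le K_2\le\delta$, $2\delta+2\le C_0,C_1\le3\delta+2$, $C_0$ even, $C_1$ odd; $C=\min(C_0,C_1)$, $C'=\max(C_0,C_1)$. Admissible means either Case II: $C\le2\delta+K_1$, $C=2K_1+2K_2+1$, $K_1+K_2\ge\delta$, $K_1+2K_2\le2\delta-1$, and either $C'=C+1$ or ($C'>C+1$, $K_1=K_2$, $3K_2=2\delta-1$); or Case III: $C>2\delta+K_1$, $K_1+2K_2\ge2\delta-1$, $3K_2\ge2\delta$, if $K_1+2K_2=2\delta-1$ then $C\ge2\delta+K_1+2$, if $C'>C+1$ then $C\ge2\delta+K_2$. Magic distance: $M\in\{1,\dots,\delta\}$ with $\max(K_1,\lceil\delta/2\rceil)\le M\le\min(K_2,\lfloor(C-\delta-1)/2\rfloor)$, with moreover $M>K_1$ if Case III holds with $K_1+2K_2=2\delta-1$, and $M<K_2$ if Case III holds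 with $C'>C+1$ and $C=2\delta+K_2$. Operation: $x\oplus y=|x-y|$ if $|x-y|>M$; otherwise $\min(x+y,C-1-x-y)$ if this is $<M$; otherwise $M$. A cycle has a tension if it has neighbouring edges with labels $a,b$ such that $a\oplus b\ne M$. -}

module Defs where

import Data.Bool
open import Data.Nat using (ℕ; zero; suc; _+_; _*_; _∸_; _≤_; _<_; _≥_; _>_; ⌈_/2⌉; ⌊_/2⌋; _⊔_; _⊓_)
open import Data.Nat.DivMod using (_%_)
open import Data.Fin using (Fin; toℕ)
open import Data.List using (List; tabulate)
open import Data.Nat.ListAction using (sum)
open import Data.Product using (Σ; _×_; ∃; ∃-syntax)
open import Data.Sum using (_⊎_)
open import Relation.Binary.PropositionalEquality using (_≡_; _≢_)
open import Relation.Nullary using (¬_)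

record Params : Set where
  field
    δ K₁ K₂ C₀ C₁ : ℕ
    δ≥3   : 3 ≤ δ
    1≤K₁  : 1 ≤ K₁
    K₁≤K₂ : K₁ ≤ K₂
    K₂≤δ  : K₂ ≤ δ
    C₀-lo : 2 * δ + 2 ≤ C₀
    C₀-hi : C₀ ≤ 3 * δ + 2
    C₁-lo : 2 * δ + 2 ≤ C₁
    C₁-hi : C₁ ≤ 3 * δ + 2
    C₀-even : C₀ % 2 ≡ 0
    C₁-odd  : C₁ % 2 ≡ 1

  C : ℕ
  C = C₀ ⊓ C₁

  C' : ℕ
  C' = C₀ ⊔ C₁

open Params public

CaseII : Params → Set
CaseII p =
  (C p ≤ 2 * δ p + K₁ p) ×
  (C p ≡ 2 * K₁ p + 2 * K₂ p + 1) ×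
  (K₁ p + K₂ p ≥ δ p) ×
  (K₁ p + 2 * K₂ p ≤ 2 * δ p ∸ 1) ×
  ((C' p ≡ C p + 1) ⊎ ((C' p > C p + 1) × (K₁ p ≡ K₂ p) × (3 * K₂ p ≡ 2 * δ p ∸ 1)))

CaseIII : Params → Set
CaseIII p =
  (C p > 2 * δ p + K₁ p) ×
  (K₁ p + 2 * K₂ p ≥ 2 * δ p ∸ 1) ×
  (3 * K₂ p ≥ 2 * δ p) ×
  (K₁ p + 2 * K₂ p ≡ 2 * δ p ∸ 1 → C p ≥ 2 * δ p + K₁ p + 2) ×
  (C' p > C p + 1 → C p ≥ 2 * δ p + K₂ p)

Admissible : Params → Set
Admissible p = CaseII p ⊎ CaseIII p

record MagicDistance (p : Params) (M : ℕ) : Set where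
  field
    1≤M : 1 ≤ M
    M≤δ : M ≤ δ p
    lo₁ : K₁ p ≤ M
    lo₂ : ⌈ δ p /2⌉ ≤ M
    hi₁ : M ≤ K₂ p
    hi₂ : M ≤ ⌊ (C p ∸ δ p ∸ 1) /2⌋
    caseIII-a : CaseIII p → K₁ p + 2 * K₂ p ≡ 2 * δ p ∸ 1 → K₁ p < M
    caseIII-b : CaseIII p → C' p > C p + 1 → C p ≡ 2 * δ p + K₂ p → M < K₂ p

-- A δ-edge-labelled cycle with k ≥ 3 vertices; edges indexed by Fin k in
-- cyclic order (edge i and edge i+1 mod k share a vertex).
record LabelledCycle (δ : ℕ) : Set where
  field
    k      : ℕ
    k≥3    : 3 ≤ k
    label  : Fin k → ℕ
    label-lo : ∀ i → 1 ≤ label i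
    label-hi : ∀ i → label i ≤ δ

open LabelledCycle public

Neighbouring : ∀ {δ} (G : LabelledCycle δ) → Fin (k G) → Fin (k G) → Set
Neighbouring G i j =
  (suc (toℕ i) ≡ toℕ j) ⊎ (suc (toℕ j) ≡ toℕ i) ⊎
  ((suc (toℕ i) ≡ k G) × (toℕ j ≡ 0)) ⊎ ((suc (toℕ j) ≡ k G) × (toℕ i ≡ 0))

perimeter : ∀ {δ} → LabelledCycle δ → ℕ
perimeter G = sum (tabulate (label G))

NonMetric : ∀ {δ} → LabelledCycle δ → Set
NonMetric G = ∃[ i ] (label G i > perimeter G ∸ label G i)

Metric : ∀ {δ} → LabelledCycle δ → Set
Metric G = ¬ NonMetric G

K₁-Cycle : (K₁ : ℕ) → ∀ {δ} → LabelledCycle δ → Set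
K₁-Cycle K₁ G = Metric G × (perimeter G % 2 ≡ 1) × (perimeter G < 2 * K₁)

-- The operation ⊕ (depends on M and C). For labels x, y ≤ δ we have
-- x + y < C - 1, so truncated subtraction is exact here.
absDiff : ℕ → ℕ → ℕ
absDiff x y = (x ∸ y) ⊔ (y ∸ x)

oplus : (M C : ℕ) → ℕ → ℕ → ℕ
oplus M C x y with M Data.Nat.<ᵇ absDiff x y
... | Data.Bool.true  = absDiff x y
... | Data.Bool.false with ((x + y) ⊓ (C ∸ 1 ∸ x ∸ y)) Data.Nat.<ᵇ M
...   | Data.Bool.true  = (x + y) ⊓ (C ∸ 1 ∸ x ∸ y)
...   | Data.Bool.false = M

HasTension : (M C : ℕ) → ∀ {δ} → LabelledCycle δ → Set
HasTension M C G = ∃[ i ] ∃[ j ] (Neighbouring G i j × (oplus M C (label G i) (label G j) ≢ M))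

-- In a K₁-cycle with at least four edges, the two disjoint pairs of consecutive
-- edges (e₀, e₁) and (e₂, e₃) have total label at most the perimeter, which is
-- below 2K₁; so one of the pairs has label sum below K₁ ≤ M.  For such a pair
-- neither |a - b| nor a + b reaches M, so a ⊕ b < M, a tension.
module Submission where

open import Defs
open import Data.Bool using (T; true; false)
open import Data.Empty using (⊥-elim)
open import Data.Fin using (Fin; toℕ)
import Data.Fin as Fin
open import Data.List using (tabulate)
open import Data.Nat using (ℕ; suc; _+_; _*_; _∸_; _⊓_; _≤_; _<_; _<ᵇ_; _<?_; s≤s; z≤n)
open import Data.Nat.ListAction using (sum)
open import Data.Nat.Properties
open import Data.Product using (_×_; _,_; ∃-syntax)
open import Data.Sum using (inj₁)
open import Relation.Binary.PropositionalEquality using (_≡_; refl; sym; cong; subst)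
open import Relation.Nullary using (yes; no)

absDiff≤+ : ∀ x y → absDiff x y ≤ x + y
absDiff≤+ x y = ⊔-lub (≤-trans (m∸n≤m x y) (m≤m+n x y)) (≤-trans (m∸n≤m y x) (m≤n+m y x))

oplus-< : ∀ M C x y → x + y < M → oplus M C x y < M
oplus-< M C x y x+y<M with M <ᵇ absDiff x y in M<|x-y|
... | true = ⊥-elim (<⇒≯ M<x+y x+y<M)
  where
  M<x+y : M < x + y
  M<x+y = <-≤-trans (<ᵇ⇒< M _ (subst T (sym M<|x-y|) _)) (absDiff≤+ x y)
... | false with (x + y) ⊓ (C ∸ 1 ∸ x ∸ y) <ᵇ M in small
...   | true  = <ᵇ⇒< _ M (subst T (sym small) _)
...   | false = ⊥-elim (subst T small (<⇒<ᵇ (≤-<-trans (m⊓n≤m (x + y) _) x+y<M)))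

first-two-pairs≤sum : ∀ {n} (f : Fin (4 + n) → ℕ) →
  (f Fin.zero + f (Fin.suc Fin.zero)) +
  (f (Fin.suc (Fin.suc Fin.zero)) + f (Fin.suc (Fin.suc (Fin.suc Fin.zero))))
    ≤ sum (tabulate f)
first-two-pairs≤sum f = begin
  (a + b) + (c + d)   ≡⟨ +-assoc a b (c + d) ⟩
  a + (b + (c + d))   ≤⟨ +-monoʳ-≤ a (+-monoʳ-≤ b (+-monoʳ-≤ c (m≤m+n d _))) ⟩
  sum (tabulate f)    ∎
  where
  open ≤-Reasoning
  a = f Fin.zero
  b = f (Fin.suc Fin.zero)
  c = f (Fin.suc (Fin.suc Fin.zero))
  d = f (Fin.suc (Fin.suc (Fin.suc Fin.zero)))

consecutive-pair-sum-< : ∀ {K} k (f : Fin k → ℕ) → 4 ≤ k → sum (tabulate f) < 2 * K →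
  ∃[ i ] ∃[ j ] (suc (toℕ i) ≡ toℕ j × f i + f j < K)
consecutive-pair-sum-< {K} (suc (suc (suc (suc n)))) f (s≤s (s≤s (s≤s (s≤s z≤n)))) sum<2K
  with f Fin.zero + f (Fin.suc Fin.zero) <? K
... | yes ab<K = Fin.zero , Fin.suc Fin.zero , refl , ab<K
... | no ab≮K with f (Fin.suc (Fin.suc Fin.zero)) + f (Fin.suc (Fin.suc (Fin.suc Fin.zero))) <? K
...   | yes cd<K = Fin.suc (Fin.suc Fin.zero) , Fin.suc (Fin.suc (Fin.suc Fin.zero)) , refl , cd<K
...   | no cd≮K = ⊥-elim (<⇒≱ sum<2K 2K≤sum)
  where
  2K≤sum : 2 * K ≤ sum (tabulate f)
  2K≤sum = begin
    2 * K       ≡⟨ cong (K +_) (+-identityʳ K) ⟩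
    K + K       ≤⟨ +-mono-≤ (≮⇒≥ ab≮K) (≮⇒≥ cd≮K) ⟩
    _           ≤⟨ first-two-pairs≤sum f ⟩
    sum (tabulate f) ∎
    where
    open ≤-Reasoning

mainTheorem5 : (p : Params) → Admissible p → (M : ℕ) → MagicDistance p M →
    (G : LabelledCycle (δ p)) → K₁-Cycle (K₁ p) G → 4 ≤ k G →
    (∃[ i ] ∃[ j ] (Neighbouring G i j × (label G i + label G j < K₁ p))) ×
    HasTension M (C p) G
mainTheorem5 p _ M magic G (_ , _ , perimeter<2K₁) 4≤k
  with consecutive-pair-sum-< (k G) (label G) 4≤k perimeter<2K₁
... | i , j , consecutive , sum<K₁ =
  (i , j , inj₁ consecutive , sum<K₁) ,
  (i , j , inj₁ consecutive , λ ⊕≡M → <-irrefl ⊕≡M (oplus-< M (C p) (label G i) (label G j) sum<M))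
  where
  sum<M : label G i + label G j < M
  sum<M = <-≤-trans sum<K₁ (MagicDistance.lo₁ magic)
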